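{- Let $D>1$ be a squarefree integer that is a product of an even number of primes, and let \[ g_D=1+\frac{\varphi(D)}{12}-\frac{\prod_{p\mid D}\left(1-\left(\frac{ -4}{p}\right)\right)}{4}-\frac{\prod_{p\mid D}\left(1-\left(\frac{ -3}{p}\right)\right)}{3}. \] If $D\notin\mathcal{E}=\{6,10,14,15,21,22,33,34,38,46,58,82,94\}$, then every prime $p\mid D$ satisfies $p<4g_D^2$.
   Context: Here $\varphi$ is Euler's totient function, products run over primes dividing $D$, and $\left(\frac{\cdot}{p}\right)$ is the Kronecker symbol. The quantity $g_D$ is the genus of the Shimura curve $X^D$ attached to the indefinite rational quaternion algebra of discriminant $D$. -}

module Defs where

open import Data.Nat as ℕ using (ℕ; zero; suc; _∸_; _^_; NonZero)
open import Data.Nat.DivMod using (_%_; _/_)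
open import Data.Nat.Divisibility using (_∣_; _∣?_)
open import Data.Nat.Primality using (Prime; prime?)
open import Data.Nat.GCD using (gcd)
open import Data.Integer as ℤ using (ℤ; +_; -[1+_])
open import Data.Integer.DivMod using (_%ℕ_)
open import Data.Rational as ℚ using (ℚ)
open import Data.List using (List; filter; upTo; length; foldr; map)
open import Data.Product using (_×_; _,_)
open import Data.Bool using (Bool; true; false; if_then_else_)
open import Relation.Nullary using (¬_; yes; no)
open import Relation.Nullary.Decidable using (_×-dec_)
open import Relation.Binary.PropositionalEquality using (_≡_)

Squarefree : ℕ → Set
Squarefree n = (p : ℕ) → Prime p → ¬ (p ℕ.* p ∣ n)

primeDivisors : ℕ → List ℕ
primeDivisors n = filter (λ p → prime? p ×-dec (p ∣? n)) (upTo (suc n))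

φ : ℕ → ℕ
φ n = length (filter (λ k → gcd (suc k) n ℕ.≟ 1) (upTo n))

-- Kronecker symbol (a/p) for p a prime.
-- p = 2: 0 if a even, 1 if a ≡ ±1 (mod 8), -1 if a ≡ ±3 (mod 8).
-- p odd: Legendre symbol, via Euler's criterion a^((p-1)/2) mod p.
kroneckerPrime : ℤ → ℕ → ℤ
kroneckerPrime a 0 = + 0
kroneckerPrime a 1 = + 0
kroneckerPrime a 2 with a %ℕ 8
... | 1 = + 1
... | 7 = + 1
... | 3 = -[1+ 0 ]
... | 5 = -[1+ 0 ]
... | _ = + 0
kroneckerPrime a p@(suc (suc (suc k))) with ((a %ℕ p) ^ ((p ∸ 1) / 2)) % p
... | 0 = + 0
... | 1 = + 1
... | _ = -[1+ 0 ]

primeProd : ℤ → ℕ → ℤ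
primeProd a D = foldr (λ p acc → (+ 1 ℤ.- kroneckerPrime a p) ℤ.* acc) (+ 1) (primeDivisors D)

genus : ℕ → ℚ
genus D = ((ℚ.1ℚ ℚ.+ ((+ φ D) ℚ./ 12))
            ℚ.- ((primeProd (-[1+ 3 ]) D) ℚ./ 4))
            ℚ.- ((primeProd (-[1+ 2 ]) D) ℚ./ 3)

exceptional : List ℕ
exceptional = 6 Data.List.∷ 10 Data.List.∷ 14 Data.List.∷ 15 Data.List.∷ 21 Data.List.∷ 22 Data.List.∷ 33 Data.List.∷ 34 Data.List.∷ 38 Data.List.∷ 46 Data.List.∷ 58 Data.List.∷ 82 Data.List.∷ 94 Data.List.∷ Data.List.[]

-- Let q₁ < ⋯ < qₙ be the prime divisors of D (n even) and X = 12 g_D = 12 + φ(D) − 3A − 4B, where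
-- A, B ≤ 2ⁿ are the two Kronecker products; p < 4 g_D² means 36 p < X². Since D is squarefree,
-- φ(D) = ∏ (qᵢ − 1), and this product outgrows 7·2ⁿ ≥ 3A + 4B. For n = 2 and n = 4 it suffices to
-- treat p = qₙ: then X ≥ qₙ − 17, resp. X ≥ 8qₙ − 108, which settles qₙ ≥ 67, resp. qₙ ≥ 17, and the
-- finitely many remaining D are decided by evaluation (this is where the exceptional set ℰ appears).
-- For n ≥ 6 every prime divisor p > q₂ satisfies (p − 1)·2^(2(n−2)) ≤ 2 φ(D), which gives X ≥ 6p + 1.
module Submission where

open import Data.Bool using (Bool; true; false; _∧_; not)
open import Data.Bool.Properties using (∧-zeroʳ; ∧-identityʳ)
open import Data.Empty using (⊥-elim)
open import Data.Integer as ℤ using (ℤ; +_; -[1+_]; +<+; +≤+)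
import Data.Integer.Properties as ℤₚ
import Data.Integer.Tactic.RingSolver as ℤ-Solver
open import Data.List using (List; []; _∷_; _∷ʳ_; filter; foldr; length; map; applyUpTo; upTo)
open import Data.List.Membership.Propositional using (_∈_; _∉_)
open import Data.List.Membership.Propositional.Properties using (∈-filter⁺; ∈-upTo⁺; ∈-++⁺ʳ)
open import Data.List.Relation.Unary.All as All using (All; []; _∷_; all?)
open import Data.List.Relation.Unary.All.Properties using (all-filter)
open import Data.List.Relation.Unary.AllPairs using (AllPairs; []; _∷_)
open import Data.List.Relation.Unary.AllPairs.Properties using (filter⁺; applyUpTo⁺₁)
open import Data.List.Relation.Unary.Any using (here; there)
open import Data.Nat
  using (ℕ; zero; suc; _+_; _*_; _∸_; _^_; _<_; _≤_; _≟_; _<?_; z≤n; s≤s; z<s; pred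
        ; NonZero; ≢-nonZero⁻¹; >-nonZero; nonTrivial⇒n>1)
open import Data.Nat.Coprimality using (Coprime; coprime⇒gcd≡1; gcd≡1⇒coprime; coprime-divisor)
open import Data.Nat.Divisibility
open import Data.Nat.DivMod using (_/_; _%_)
open import Data.Nat.GCD using (gcd)
open import Data.Nat.ListAction using (product)
open import Data.Nat.ListAction.Properties using (∈⇒∣product)
open import Data.Nat.Primality using (Prime; prime?; prime⇒irreducible; prime⇒nonTrivial; prime⇒¬composite; ¬prime[1]; composite[4])
open import Data.Nat.Primality.Factorisation using (factorise; factorisationHasAllPrimeFactors)
open import Data.Nat.Properties
open import Algebra.Properties.CommutativeSemigroup +-commutativeSemigroup using (interchange)
open import Data.Nat.Tactic.RingSolver using (solve-∀)
open import Data.List.Membership.DecPropositional _≟_ using (_∈?_)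
open import Data.Product using (_×_; _,_; proj₁; ∃-syntax)
open import Data.Rational as ℚ using (toℚᵘ)
open import Data.Rational.Properties using (toℚᵘ-homo-+; toℚᵘ-homo‿-; toℚᵘ-homo-*; toℚᵘ-fromℚᵘ; toℚᵘ-cancel-<)
open import Data.Rational.Unnormalised as ℚᵘ using (mkℚᵘ; *≡*; *<*)
import Data.Rational.Unnormalised.Properties as ℚᵘₚ
open import Data.Sum using (_⊎_; inj₁; inj₂)
open import Defs
open import Function using (_∘_; _⇔_; mk⇔; Equivalence)
open import Relation.Binary.PropositionalEquality
open import Relation.Nullary using (¬_; Dec; yes; no; does; ¬?; _→-dec_; from-yes)
open import Relation.Nullary.Decidable using (dec-true; dec-false; does-⇔; _×-dec_)
open import Relation.Nullary.Negation using (contradiction)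
open import Relation.Unary using (Pred; Decidable)

-- Counting

𝟙 : Bool → ℕ
𝟙 true  = 1
𝟙 false = 0

count : (ℕ → Bool) → ℕ → ℕ
count P zero    = 0
count P (suc n) = 𝟙 (P 0) + count (P ∘ suc) n

length-filter-applyUpTo : ∀ {ℓ} {Q : Pred ℕ ℓ} (Q? : Decidable Q) f n →
  length (filter Q? (applyUpTo f n)) ≡ count (λ k → does (Q? (f k))) n
length-filter-applyUpTo Q? f zero = refl
length-filter-applyUpTo Q? f (suc n) with does (Q? (f 0))
... | true  = cong suc (length-filter-applyUpTo Q? (f ∘ suc) n)
... | false = length-filter-applyUpTo Q? (f ∘ suc) n

count-cong : ∀ {P Q} n → (∀ k → P k ≡ Q k) → count P n ≡ count Q n
count-cong zero    P≗Q = refl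
count-cong (suc n) P≗Q = cong₂ _+_ (cong 𝟙 (P≗Q 0)) (count-cong n (P≗Q ∘ suc))

count-+ : ∀ (P : ℕ → Bool) m n → count P (m + n) ≡ count P m + count (λ k → P (m + k)) n
count-+ P zero    n = refl
count-+ P (suc m) n = begin
  𝟙 (P 0) + count (P ∘ suc) (m + n)                             ≡⟨ cong (_+_ (𝟙 (P 0))) (count-+ (P ∘ suc) m n) ⟩
  𝟙 (P 0) + (count (P ∘ suc) m + count (λ k → P (suc m + k)) n) ≡⟨ +-assoc (𝟙 (P 0)) _ _ ⟨
  count P (suc m) + count (λ k → P (suc m + k)) n               ∎
  where open ≡-Reasoning

count-periodic : ∀ (P : ℕ → Bool) m → (∀ k → P (m + k) ≡ P k) → ∀ j → count P (j * m) ≡ j * count P m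
count-periodic P m periodic zero    = refl
count-periodic P m periodic (suc j) = begin
  count P (m + j * m)                     ≡⟨ count-+ P m (j * m) ⟩
  count P m + count (λ k → P (m + k)) (j * m) ≡⟨ cong (_+_ (count P m)) (count-cong (j * m) periodic) ⟩
  count P m + count P (j * m)             ≡⟨ cong (_+_ (count P m)) (count-periodic P m periodic j) ⟩
  count P m + j * count P m               ∎
  where open ≡-Reasoning

count-∧-not : ∀ (P Q : ℕ → Bool) n → count P n ≡ count (λ k → P k ∧ Q k) n + count (λ k → P k ∧ not (Q k)) n
count-∧-not P Q zero    = refl
count-∧-not P Q (suc n) = begin
  𝟙 (P 0) + count (P ∘ suc) n
    ≡⟨ cong₂ _+_ (split (P 0) (Q 0)) (count-∧-not (P ∘ suc) (Q ∘ suc) n) ⟩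
  (𝟙 (P 0 ∧ Q 0) + 𝟙 (P 0 ∧ not (Q 0))) + (count (λ k → P (suc k) ∧ Q (suc k)) n + count (λ k → P (suc k) ∧ not (Q (suc k))) n)
    ≡⟨ interchange (𝟙 (P 0 ∧ Q 0)) _ _ _ ⟩
  count (λ k → P k ∧ Q k) (suc n) + count (λ k → P k ∧ not (Q k)) (suc n) ∎
  where
  open ≡-Reasoning
  split : ∀ a b → 𝟙 a ≡ 𝟙 (a ∧ b) + 𝟙 (a ∧ not b)
  split true  true  = refl
  split true  false = refl
  split false b     = refl

count-last : ∀ (P : ℕ → Bool) n → count P (suc n) ≡ count P n + 𝟙 (P n)
count-last P zero    = +-identityʳ (𝟙 (P 0))
count-last P (suc n) = begin
  𝟙 (P 0) + count (P ∘ suc) (suc n)              ≡⟨ cong (_+_ (𝟙 (P 0))) (count-last (P ∘ suc) n) ⟩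
  𝟙 (P 0) + (count (P ∘ suc) n + 𝟙 (P (suc n))) ≡⟨ +-assoc (𝟙 (P 0)) _ _ ⟨
  count P (suc n) + 𝟙 (P (suc n))                ∎
  where open ≡-Reasoning

count-false : ∀ (P : ℕ → Bool) n → (∀ k → k < n → P k ≡ false) → count P n ≡ 0
count-false P zero    _      = refl
count-false P (suc n) P≡false rewrite P≡false 0 (s≤s z≤n) =
  count-false (P ∘ suc) n (λ k k<n → P≡false (suc k) (s≤s k<n))

count-multiple-in-block : ∀ (P : ℕ → Bool) q .{{_ : NonZero q}} → count (λ k → P (suc k) ∧ does (q ∣? suc k)) q ≡ 𝟙 (P q)
count-multiple-in-block P (suc q′) = begin
  count P′ (suc q′)       ≡⟨ count-last P′ q′ ⟩
  count P′ q′ + 𝟙 (P′ q′)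
    ≡⟨ cong₂ _+_ (count-false P′ q′ not-multiple) (cong (𝟙 ∘ (P (suc q′) ∧_)) (dec-true (suc q′ ∣? suc q′) ∣-refl)) ⟩
  𝟙 (P (suc q′) ∧ true)   ≡⟨ cong 𝟙 (∧-identityʳ (P (suc q′))) ⟩
  𝟙 (P (suc q′))          ∎
  where
  open ≡-Reasoning
  P′ : ℕ → Bool
  P′ k = P (suc k) ∧ does (suc q′ ∣? suc k)
  not-multiple : ∀ k → k < q′ → P′ k ≡ false
  not-multiple k k<q′ =
    trans (cong (P (suc k) ∧_) (dec-false (suc q′ ∣? suc k) (<⇒≱ (s≤s k<q′) ∘ ∣⇒≤))) (∧-zeroʳ (P (suc k)))

-- As k ranges below q·m, suc k ranges over 1, …, q·m, whose multiples of q are q·1, …, q·m.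
count-multiples : ∀ (P : ℕ → Bool) q m .{{_ : NonZero q}} →
  count (λ k → P (suc k) ∧ does (q ∣? suc k)) (q * m) ≡ count (λ i → P (q * suc i)) m
count-multiples P q zero    = cong (count _) (*-zeroʳ q)
count-multiples P q (suc m) = begin
  count P′ (q * suc m)                          ≡⟨ cong (count P′) (*-suc q m) ⟩
  count P′ (q + q * m)                          ≡⟨ count-+ P′ q (q * m) ⟩
  count P′ q + count (λ k → P′ (q + k)) (q * m)  ≡⟨ cong₂ _+_ (count-multiple-in-block P q) (count-cong (q * m) shift) ⟩
  𝟙 (P q) + count (λ k → P (q + suc k) ∧ does (q ∣? suc k)) (q * m)
    ≡⟨ cong₂ _+_ (sym (cong (𝟙 ∘ P) (*-identityʳ q))) (count-multiples (P ∘ (_+_ q)) q m) ⟩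
  𝟙 (P (q * 1)) + count (λ i → P (q + q * suc i)) m
    ≡⟨ cong (_+_ (𝟙 (P (q * 1)))) (count-cong m (λ i → sym (cong P (*-suc q (suc i))))) ⟩
  count (λ i → P (q * suc i)) (suc m) ∎
  where
  open ≡-Reasoning
  P′ : ℕ → Bool
  P′ k = P (suc k) ∧ does (q ∣? suc k)
  shift : ∀ k → P′ (q + k) ≡ (P (q + suc k) ∧ does (q ∣? suc k))
  shift k = cong₂ _∧_ (cong P (sym (+-suc q k))) (does-⇔ (mk⇔
    (λ q∣ → ∣m+n∣m⇒∣n (subst (q ∣_) (sym (+-suc q k)) q∣) ∣-refl)
    (λ q∣ → subst (q ∣_) (+-suc q k) (∣m∣n⇒∣m+n ∣-refl q∣))) (q ∣? suc (q + k)) (q ∣? suc k))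

-- Euler's totient

coprimeᵇ : ℕ → ℕ → Bool
coprimeᵇ a b = does (gcd a b ≟ 1)

coprimeᵇ-cong : ∀ {a b c d} → Coprime a b ⇔ Coprime c d → coprimeᵇ a b ≡ coprimeᵇ c d
coprimeᵇ-cong {a} {b} {c} {d} a,b⇔c,d = does-⇔
  (mk⇔ (coprime⇒gcd≡1 ∘ Equivalence.to a,b⇔c,d ∘ gcd≡1⇒coprime)
       (coprime⇒gcd≡1 ∘ Equivalence.from a,b⇔c,d ∘ gcd≡1⇒coprime))
  (gcd a b ≟ 1) (gcd c d ≟ 1)

φ≡count : ∀ n → φ n ≡ count (λ k → coprimeᵇ (suc k) n) n
φ≡count n = length-filter-applyUpTo (λ k → gcd (suc k) n ≟ 1) (λ k → k) n

coprime-+ˡ : ∀ {m n} → Coprime (m + n) m ⇔ Coprime n m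
coprime-+ˡ = mk⇔
  (λ coprime {_} (i∣n , i∣m) → coprime (∣m∣n⇒∣m+n i∣m i∣n , i∣m))
  (λ coprime {_} (i∣m+n , i∣m) → coprime (∣m+n∣m⇒∣n i∣m+n i∣m , i∣m))

prime∤⇒coprime : ∀ {p n} → Prime p → ¬ p ∣ n → Coprime p n
prime∤⇒coprime p-prime p∤n {_} (i∣p , i∣n) with prime⇒irreducible p-prime i∣p
... | inj₁ i≡1    = i≡1
... | inj₂ refl   = ⊥-elim (p∤n i∣n)

coprime-*ʳ-prime : ∀ {q k m} → Prime q → ¬ q ∣ k → Coprime k (q * m) ⇔ Coprime k m
coprime-*ʳ-prime {q} q-prime q∤k = mk⇔
  (λ coprime {_} (i∣k , i∣m) → coprime (i∣k , ∣n⇒∣m*n q i∣m))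
  (λ coprime {_} (i∣k , i∣qm) → coprime (i∣k , coprime-divisor (λ {_} (j∣i , j∣q) → q⊥k (j∣q , ∣-trans j∣i i∣k)) i∣qm))
  where q⊥k = prime∤⇒coprime q-prime q∤k

¬coprime-*ʳ-prime : ∀ {q k m} → Prime q → q ∣ k → ¬ Coprime k (q * m)
¬coprime-*ʳ-prime {m = m} q-prime q∣k coprime = ¬prime[1] (subst Prime (coprime (q∣k , m∣m*n m)) q-prime)

coprime-*ˡ : ∀ {q i m} → Coprime q m → Coprime (q * i) m ⇔ Coprime i m
coprime-*ˡ {q} q⊥m = mk⇔
  (λ coprime {_} (j∣i , j∣m) → coprime (∣n⇒∣m*n q j∣i , j∣m))
  (λ coprime {_} (j∣qi , j∣m) → coprime (coprime-divisor (λ {_} (l∣j , l∣q) → q⊥m (l∣q , ∣-trans l∣j j∣m)) j∣qi , j∣m))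

-- Of 1, …, q·m, exactly q·φ(m) are coprime to m; those divisible by q are the q·i with i coprime
-- to m, and the others are exactly the numbers coprime to q·m.
φ-*-prime : ∀ {q} m → Prime q → ¬ q ∣ m → φ (q * m) ≡ pred q * φ m
φ-*-prime {q@(suc q′)} m q-prime q∤m = +-cancelˡ-≡ (φ m) _ _ (sym (begin
  q * φ m
    ≡⟨ cong (q *_) (φ≡count m) ⟩
  q * count C m
    ≡⟨ count-periodic C m C-periodic q ⟨
  count C (q * m)
    ≡⟨ count-∧-not C Q (q * m) ⟩
  count (λ k → C k ∧ Q k) (q * m) + count (λ k → C k ∧ not (Q k)) (q * m)
    ≡⟨ cong (_+ count (λ k → C k ∧ not (Q k)) (q * m)) (count-multiples (λ k → coprimeᵇ k m) q m) ⟩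
  count (λ i → coprimeᵇ (q * suc i) m) m + count (λ k → C k ∧ not (Q k)) (q * m)
    ≡⟨ cong₂ _+_ (count-cong m (λ i → coprimeᵇ-cong (coprime-*ˡ {q} {suc i} (prime∤⇒coprime q-prime q∤m))))
                 (count-cong (q * m) not-multiple) ⟩
  count C m + count (λ k → coprimeᵇ (suc k) (q * m)) (q * m)
    ≡⟨ cong₂ _+_ (φ≡count m) (φ≡count (q * m)) ⟨
  φ m + φ (q * m) ∎))
  where
  open ≡-Reasoning
  C Q : ℕ → Bool
  C k = coprimeᵇ (suc k) m
  Q k = does (q ∣? suc k)
  C-periodic : ∀ k → C (m + k) ≡ C k
  C-periodic k = trans (cong (λ j → coprimeᵇ j m) (sym (+-suc m k))) (coprimeᵇ-cong (coprime-+ˡ {m} {suc k}))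
  not-multiple : ∀ k → (C k ∧ not (Q k)) ≡ coprimeᵇ (suc k) (q * m)
  not-multiple k = by-cases (q ∣? suc k)
    where
    by-cases : (q∣? : Dec (q ∣ suc k)) → (C k ∧ not (does q∣?)) ≡ coprimeᵇ (suc k) (q * m)
    by-cases (yes q∣k) = trans (∧-zeroʳ (C k))
      (sym (dec-false (gcd (suc k) (q * m) ≟ 1) (¬coprime-*ʳ-prime {q} {suc k} {m} q-prime q∣k ∘ gcd≡1⇒coprime)))
    by-cases (no  q∤k) = trans (∧-identityʳ (C k)) (sym (coprimeᵇ-cong (coprime-*ʳ-prime {q} {suc k} {m} q-prime q∤k)))

-- Prime divisors of squarefree numbers

primeDivisors-increasing : ∀ D → AllPairs _<_ (primeDivisors D)
primeDivisors-increasing D = filter⁺ (λ p → prime? p ×-dec p ∣? D) (applyUpTo⁺₁ (λ k → k) (suc D) (λ i<j _ → i<j))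

primeDivisors-prime∣ : ∀ D → All (λ p → Prime p × p ∣ D) (primeDivisors D)
primeDivisors-prime∣ D = all-filter (λ p → prime? p ×-dec p ∣? D) (upTo (suc D))

∈-primeDivisors : ∀ {D p} .{{_ : NonZero D}} → Prime p → p ∣ D → p ∈ primeDivisors D
∈-primeDivisors {D} p-prime p∣D = ∈-filter⁺ (λ p → prime? p ×-dec p ∣? D) (∈-upTo⁺ (s≤s (∣⇒≤ p∣D))) (p-prime , p∣D)

coprime⇒*∣ : ∀ {a b n} → Coprime a b → a ∣ n → b ∣ n → a * b ∣ n
coprime⇒*∣ {a} {b} a⊥b a∣n (divides k refl) = subst (a * b ∣_) (*-comm b k)
  (subst (_∣ b * k) (*-comm b a) (*-monoʳ-∣ b (coprime-divisor a⊥b (subst (a ∣_) (*-comm k b) a∣n))))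

prime∤product : ∀ {q L} → Prime q → All (q <_) L → All Prime L → ¬ q ∣ product L
prime∤product q-prime q<L L-prime q∣ΠL = <-irrefl refl (All.lookup q<L (factorisationHasAllPrimeFactors q-prime q∣ΠL L-prime))

product∣ : ∀ {D L} → AllPairs _<_ L → All (λ p → Prime p × p ∣ D) L → product L ∣ D
product∣ []                   []                     = 1∣ _
product∣ (q<L ∷ L-increasing) ((q-prime , q∣D) ∷ L∣D) = coprime⇒*∣
  (prime∤⇒coprime q-prime (prime∤product q-prime q<L (All.map proj₁ L∣D))) q∣D (product∣ L-increasing L∣D)

∃prime∣ : ∀ {n} → 1 < n → ∃[ p ] Prime p × p ∣ n
∃prime∣ {n@(suc _)} 1<n with factorise n
... | record { factors = p ∷ ps ; isFactorisation = n≡Π ; factorsPrime = p-prime ∷ _ } =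
  p , p-prime , subst (p ∣_) (sym n≡Π) (m∣m*n (product ps))
... | record { factors = [] ; isFactorisation = refl } = ⊥-elim (<-irrefl refl 1<n)

product-primeDivisors : ∀ {D} .{{_ : NonZero D}} → Squarefree D → product (primeDivisors D) ≡ D
product-primeDivisors {D} squarefree with product∣ (primeDivisors-increasing D) (primeDivisors-prime∣ D)
... | divides r D≡rΠ = cofactor≡1 r D≡rΠ
  where
  Π = product (primeDivisors D)
  cofactor≡1 : ∀ r → D ≡ r * Π → Π ≡ D
  cofactor≡1 0 D≡0 = ⊥-elim (≢-nonZero⁻¹ D D≡0)
  cofactor≡1 1 D≡Π = sym (trans D≡Π (+-identityʳ Π))
  cofactor≡1 r@(suc (suc _)) D≡rΠ with ∃prime∣ {r} (s≤s (s≤s z≤n))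
  ... | p , p-prime , p∣r = ⊥-elim (squarefree p p-prime (subst (p * p ∣_) (sym D≡rΠ) (*-pres-∣ p∣r p∣Π)))
    where
    p∣Π : p ∣ Π
    p∣Π = ∈⇒∣product (∈-primeDivisors p-prime (subst (p ∣_) (sym D≡rΠ) (∣m⇒∣m*n Π p∣r)))

φ-product-primes : ∀ {L} → AllPairs _<_ L → All Prime L → φ (product L) ≡ product (map pred L)
φ-product-primes {[]}    []                   []                 = refl
φ-product-primes {q ∷ L} (q<L ∷ L-increasing) (q-prime ∷ L-prime) = trans
  (φ-*-prime (product L) q-prime (prime∤product q-prime q<L L-prime))
  (cong (pred q *_) (φ-product-primes L-increasing L-prime))

φ-squarefree : ∀ {D} .{{_ : NonZero D}} → Squarefree D → φ D ≡ product (map pred (primeDivisors D))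
φ-squarefree {D} squarefree = trans (cong φ (sym (product-primeDivisors squarefree)))
  (φ-product-primes (primeDivisors-increasing D) (All.map proj₁ (primeDivisors-prime∣ D)))

-- The genus formula

kroneckerPrime∈0±1 : ∀ a p → kroneckerPrime a p ≡ + 0 ⊎ kroneckerPrime a p ≡ + 1 ⊎ kroneckerPrime a p ≡ -[1+ 0 ]
kroneckerPrime∈0±1 a 0 = inj₁ refl
kroneckerPrime∈0±1 a 1 = inj₁ refl
kroneckerPrime∈0±1 a 2 with a ℤ.%ℕ 8
... | 0 = inj₁ refl
... | 1 = inj₂ (inj₁ refl)
... | 2 = inj₁ refl
... | 3 = inj₂ (inj₂ refl)
... | 4 = inj₁ refl
... | 5 = inj₂ (inj₂ refl)
... | 6 = inj₁ refl
... | 7 = inj₂ (inj₁ refl)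
... | suc (suc (suc (suc (suc (suc (suc (suc _))))))) = inj₁ refl
kroneckerPrime∈0±1 a p@(suc (suc (suc _))) with ((a ℤ.%ℕ p) ^ ((p ∸ 1) / 2)) % p
... | 0 = inj₁ refl
... | 1 = inj₂ (inj₁ refl)
... | suc (suc _) = inj₂ (inj₂ refl)

localFactor : ℤ → ℕ → ℕ
localFactor a p = ℤ.∣ + 1 ℤ.- kroneckerPrime a p ∣

+localFactor : ∀ a p → + localFactor a p ≡ + 1 ℤ.- kroneckerPrime a p
+localFactor a p with kroneckerPrime∈0±1 a p
... | inj₁ k≡0        rewrite k≡0 = refl
... | inj₂ (inj₁ k≡1) rewrite k≡1 = refl
... | inj₂ (inj₂ k≡-1) rewrite k≡-1 = refl

localFactor≤2 : ∀ a p → localFactor a p ≤ 2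
localFactor≤2 a p with kroneckerPrime∈0±1 a p
... | inj₁ k≡0        rewrite k≡0 = s≤s z≤n
... | inj₂ (inj₁ k≡1) rewrite k≡1 = z≤n
... | inj₂ (inj₂ k≡-1) rewrite k≡-1 = ≤-refl

primeProd≡product : ∀ a D → primeProd a D ≡ + product (map (localFactor a) (primeDivisors D))
primeProd≡product a D = foldr≡product (primeDivisors D)
  where
  foldr≡product : ∀ L → foldr (λ p acc → (+ 1 ℤ.- kroneckerPrime a p) ℤ.* acc) (+ 1) L ≡ + product (map (localFactor a) L)
  foldr≡product []      = refl
  foldr≡product (p ∷ L) = trans (cong₂ ℤ._*_ (sym (+localFactor a p)) (foldr≡product L)) (sym (ℤₚ.pos-* (localFactor a p) _))

product-localFactor≤ : ∀ a L → product (map (localFactor a) L) ≤ 2 ^ length L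
product-localFactor≤ a []      = ≤-refl
product-localFactor≤ a (p ∷ L) = *-mono-≤ (localFactor≤2 a p) (product-localFactor≤ a L)

genusNumerator : ℕ → ℤ → ℤ → ℤ
genusNumerator f A B = + 12 ℤ.+ + f ℤ.- + 3 ℤ.* A ℤ.- + 4 ℤ.* B

toℚᵘ-/ : ∀ n d → toℚᵘ (n ℚ./ suc d) ℚᵘ.≃ mkℚᵘ n d
toℚᵘ-/ n d = toℚᵘ-fromℚᵘ (mkℚᵘ n d)

toℚᵘ-+ : ∀ {p q p′ q′} → toℚᵘ p ℚᵘ.≃ p′ → toℚᵘ q ℚᵘ.≃ q′ → toℚᵘ (p ℚ.+ q) ℚᵘ.≃ p′ ℚᵘ.+ q′
toℚᵘ-+ {p} {q} p≃ q≃ = ℚᵘₚ.≃-trans (toℚᵘ-homo-+ p q) (ℚᵘₚ.+-cong p≃ q≃)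

toℚᵘ-− : ∀ {p q p′ q′} → toℚᵘ p ℚᵘ.≃ p′ → toℚᵘ q ℚᵘ.≃ q′ → toℚᵘ (p ℚ.- q) ℚᵘ.≃ p′ ℚᵘ.- q′
toℚᵘ-− {p} {q} p≃ q≃ = toℚᵘ-+ {p} {ℚ.- q} p≃ (ℚᵘₚ.≃-trans (toℚᵘ-homo‿- q) (ℚᵘₚ.-‿cong q≃))

toℚᵘ-* : ∀ {p q p′ q′} → toℚᵘ p ℚᵘ.≃ p′ → toℚᵘ q ℚᵘ.≃ q′ → toℚᵘ (p ℚ.* q) ℚᵘ.≃ p′ ℚᵘ.* q′
toℚᵘ-* {p} {q} p≃ q≃ = ℚᵘₚ.≃-trans (toℚᵘ-homo-* p q) (ℚᵘₚ.*-cong p≃ q≃)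

toℚᵘ-genus : ∀ D → toℚᵘ (genus D) ℚᵘ.≃ mkℚᵘ (genusNumerator (φ D) (primeProd -[1+ 3 ] D) (primeProd -[1+ 2 ] D)) 11
toℚᵘ-genus D = ℚᵘₚ.≃-trans
  (toℚᵘ-− (toℚᵘ-− (toℚᵘ-+ {ℚ.1ℚ} ℚᵘₚ.≃-refl (toℚᵘ-/ (+ φ D) 11)) (toℚᵘ-/ (primeProd -[1+ 3 ] D) 3))
           (toℚᵘ-/ (primeProd -[1+ 2 ] D) 2))
  (*≡* (common-denominator (+ φ D) (primeProd -[1+ 3 ] D) (primeProd -[1+ 2 ] D)))
  where
  -- the left side is what ℚᵘ arithmetic makes of 1 + f/12 − A/4 − B/3, cross-multiplied by 12
  common-denominator : ∀ f A B →
    (((+ 1 ℤ.* + 12 ℤ.+ f ℤ.* + 1) ℤ.* + 4 ℤ.+ (ℤ.- A) ℤ.* + 12) ℤ.* + 3 ℤ.+ (ℤ.- B) ℤ.* + 48) ℤ.* + 12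
      ≡ (+ 12 ℤ.+ f ℤ.- + 3 ℤ.* A ℤ.- + 4 ℤ.* B) ℤ.* + 144
  common-denominator = ℤ-Solver.solve-∀

36p<X²⇒p<4g² : ∀ p g X → toℚᵘ g ℚᵘ.≃ mkℚᵘ X 11 → + (36 * p) ℤ.< X ℤ.* X →
               + p ℚ./ 1 ℚ.< + 4 ℚ./ 1 ℚ.* (g ℚ.* g)
36p<X²⇒p<4g² p g X g≃X/12 36p<X² = toℚᵘ-cancel-<
  (ℚᵘₚ.<-respˡ-≃ (ℚᵘₚ.≃-sym (toℚᵘ-/ (+ p) 0))
  (ℚᵘₚ.<-respʳ-≃ (ℚᵘₚ.≃-sym (toℚᵘ-* (toℚᵘ-/ (+ 4) 0) (toℚᵘ-* g≃X/12 g≃X/12)))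
  (*<* cross-multiplied)))
  where
  rescale : + 4 ℤ.* + (36 * p) ≡ + p ℤ.* + 144
  rescale = begin
    + 4 ℤ.* + (36 * p) ≡⟨ ℤₚ.pos-* 4 (36 * p) ⟨
    + (4 * (36 * p))   ≡⟨ cong +_ (trans (sym (*-assoc 4 36 p)) (*-comm 144 p)) ⟩
    + (p * 144)        ≡⟨ ℤₚ.pos-* p 144 ⟩
    + p ℤ.* + 144      ∎
    where open ≡-Reasoning
  cross-multiplied : + p ℤ.* + 144 ℤ.< (+ 4 ℤ.* (X ℤ.* X)) ℤ.* + 1
  cross-multiplied = subst₂ ℤ._<_ rescale (sym (ℤₚ.*-identityʳ _)) (ℤₚ.*-monoˡ-<-pos (+ 4) 36p<X²)

-- Bounding the genus from below

-- 12 g_D, computed from the list L of prime divisors of D; Below4g² L p then says p < 4 g_D².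
numerator : List ℕ → ℤ
numerator L = genusNumerator (product (map pred L)) (+ product (map (localFactor -[1+ 3 ]) L)) (+ product (map (localFactor -[1+ 2 ]) L))

Below4g² : List ℕ → ℕ → Set
Below4g² L p = + (36 * p) ℤ.< numerator L ℤ.* numerator L

below4g²? : ∀ L p → Dec (Below4g² L p)
below4g²? L p = + (36 * p) ℤ.<? numerator L ℤ.* numerator L

below4g²-mono : ∀ L {p q} → p ≤ q → Below4g² L q → Below4g² L p
below4g²-mono L p≤q = ℤₚ.≤-<-trans (+≤+ (*-monoʳ-≤ 36 p≤q))

genusNumerator≡ : ∀ {f a b c} → 3 * a + 4 * b + c ≡ 12 + f → genusNumerator f (+ a) (+ b) ≡ + c
genusNumerator≡ {f} {a} {b} {c} sum≡ = begin
  + 12 ℤ.+ + f ℤ.- + 3 ℤ.* + a ℤ.- + 4 ℤ.* + b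
    ≡⟨ cong (λ z → z ℤ.- + 3 ℤ.* + a ℤ.- + 4 ℤ.* + b) lift-sum≡ ⟨
  + 3 ℤ.* + a ℤ.+ + 4 ℤ.* + b ℤ.+ + c ℤ.- + 3 ℤ.* + a ℤ.- + 4 ℤ.* + b
    ≡⟨ cancel (+ a) (+ b) (+ c) ⟩
  + c ∎
  where
  open ≡-Reasoning
  cancel : ∀ A B C → + 3 ℤ.* A ℤ.+ + 4 ℤ.* B ℤ.+ C ℤ.- + 3 ℤ.* A ℤ.- + 4 ℤ.* B ≡ C
  cancel = ℤ-Solver.solve-∀
  lift-sum≡ : + 3 ℤ.* + a ℤ.+ + 4 ℤ.* + b ℤ.+ + c ≡ + 12 ℤ.+ + f
  lift-sum≡ = begin
    + 3 ℤ.* + a ℤ.+ + 4 ℤ.* + b ℤ.+ + c ≡⟨ cong₂ (λ x y → x ℤ.+ y ℤ.+ + c) (ℤₚ.pos-* 3 a) (ℤₚ.pos-* 4 b) ⟨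
    + (3 * a) ℤ.+ + (4 * b) ℤ.+ + c     ≡⟨ cong (ℤ._+ + c) (ℤₚ.pos-+ (3 * a) (4 * b)) ⟨
    + (3 * a + 4 * b) ℤ.+ + c           ≡⟨ ℤₚ.pos-+ (3 * a + 4 * b) c ⟨
    + (3 * a + 4 * b + c)               ≡⟨ cong +_ sum≡ ⟩
    + (12 + f)                          ≡⟨ ℤₚ.pos-+ 12 f ⟩
    + 12 ℤ.+ + f                        ∎

numerator≥ : ∀ L {Y} → 7 * 2 ^ length L + Y ≤ 12 + product (map pred L) → ∃[ e ] numerator L ≡ + (Y + e)
numerator≥ L {Y} bound =
  let e , sum≡ = m≤n⇒∃[o]m+o≡n (≤-trans (+-monoˡ-≤ Y 3a+4b≤7·2ⁿ) bound)
  in e , genusNumerator≡ {a = a} {b} (trans (sym (+-assoc (3 * a + 4 * b) Y e)) sum≡)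
  where
  a = product (map (localFactor -[1+ 3 ]) L)
  b = product (map (localFactor -[1+ 2 ]) L)
  3a+4b≤7·2ⁿ : 3 * a + 4 * b ≤ 7 * 2 ^ length L
  3a+4b≤7·2ⁿ = ≤-trans (+-mono-≤ (*-monoʳ-≤ 3 (product-localFactor≤ -[1+ 3 ] L)) (*-monoʳ-≤ 4 (product-localFactor≤ -[1+ 2 ] L)))
                       (≤-reflexive (sym (*-distribʳ-+ (2 ^ length L) 3 4)))

below4g²-by : ∀ L p Y → 7 * 2 ^ length L + Y ≤ 12 + product (map pred L) → 36 * p < Y * Y → Below4g² L p
below4g²-by L p Y bound 36p<Y² with numerator≥ L bound
... | e , X≡Y+e rewrite X≡Y+e =
  subst (+ (36 * p) ℤ.<_) (ℤₚ.pos-* (Y + e) (Y + e)) (+<+ (<-≤-trans 36p<Y² (*-mono-≤ (m≤m+n Y e) (m≤m+n Y e))))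

primesBelow : ℕ → List ℕ
primesBelow n = filter prime? (upTo n)

∈-primesBelow : ∀ {p n} → Prime p → p < n → p ∈ primesBelow n
∈-primesBelow p-prime p<n = ∈-filter⁺ prime? (∈-upTo⁺ p<n) p-prime

pairsBelow67 : All (λ x → All (λ y →
  x < y → product (x ∷ y ∷ []) ∉ exceptional → Below4g² (x ∷ y ∷ []) y) (primesBelow 67)) (primesBelow 67)
pairsBelow67 = from-yes (all? (λ x → all? (λ y →
  x <? y →-dec ¬? (product (x ∷ y ∷ []) ∈? exceptional) →-dec below4g²? (x ∷ y ∷ []) y) (primesBelow 67)) (primesBelow 67))

quadruplesBelow17 : All (λ a → All (λ b → All (λ c → All (λ d →
  a < b → b < c → c < d → Below4g² (a ∷ b ∷ c ∷ d ∷ []) d) (primesBelow 17)) (primesBelow 17)) (primesBelow 17)) (primesBelow 17)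
quadruplesBelow17 = from-yes (all? (λ a → all? (λ b → all? (λ c → all? (λ d →
  a <? b →-dec b <? c →-dec c <? d →-dec below4g²? (a ∷ b ∷ c ∷ d ∷ []) d)
  (primesBelow 17)) (primesBelow 17)) (primesBelow 17)) (primesBelow 17))

prime⇒2≤ : ∀ {p} → Prime p → 2 ≤ p
prime⇒2≤ {p} p-prime = nonTrivial⇒n>1 p {{prime⇒nonTrivial p-prime}}

prime-4≤⇒5≤ : ∀ {p} → Prime p → 4 ≤ p → 5 ≤ p
prime-4≤⇒5≤ p-prime 4≤p with m≤n⇒m<n∨m≡n 4≤p
... | inj₁ 4<p  = 4<p
... | inj₂ refl = contradiction composite[4] (prime⇒¬composite p-prime)

≤-last : ∀ xs {y p} → AllPairs _<_ (xs ∷ʳ y) → p ∈ xs ∷ʳ y → p ≤ y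
≤-last []       _               (here refl) = ≤-refl
≤-last (x ∷ xs) (x<xs∷ʳy ∷ _)   (here refl) = <⇒≤ (All.lookup x<xs∷ʳy (∈-++⁺ʳ xs (here refl)))
≤-last (x ∷ xs) (_ ∷ increasing) (there p∈) = ≤-last xs increasing p∈

2^length²≤product-pred : ∀ {R} → All (5 ≤_) R → 2 ^ length R * 2 ^ length R ≤ product (map pred R)
2^length²≤product-pred         []          = ≤-refl
2^length²≤product-pred {q ∷ R} (5≤q ∷ 5≤R) = begin
  (2 * t) * (2 * t)            ≡⟨ square-double t ⟩
  4 * (t * t)                  ≤⟨ *-mono-≤ (pred-mono-≤ 5≤q) (2^length²≤product-pred 5≤R) ⟩
  pred q * product (map pred R) ∎
  where
  open ≤-Reasoning
  t = 2 ^ length R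
  square-double : ∀ t → (2 * t) * (2 * t) ≡ 4 * (t * t)
  square-double = solve-∀

pred*2^length²≤ : ∀ {R r} → All (5 ≤_) R → r ∈ R → pred r * (2 ^ length R * 2 ^ length R) ≤ 4 * product (map pred R)
pred*2^length²≤ {q ∷ R} {r} (5≤q ∷ 5≤R) r∈qR = begin
  pred r * ((2 * t) * (2 * t))  ≡⟨ rearrange (pred r) t ⟩
  4 * (pred r * (t * t))        ≤⟨ *-monoʳ-≤ 4 (bound r∈qR) ⟩
  4 * product (map pred (q ∷ R)) ∎
  where
  open ≤-Reasoning
  t = 2 ^ length R
  rearrange : ∀ a t → a * ((2 * t) * (2 * t)) ≡ 4 * (a * (t * t))
  rearrange = solve-∀
  bound : r ∈ q ∷ R → pred r * (t * t) ≤ product (map pred (q ∷ R))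
  bound (here refl) = *-monoʳ-≤ (pred q) (2^length²≤product-pred 5≤R)
  bound (there r∈R) = ≤-trans (pred*2^length²≤ 5≤R r∈R) (*-monoˡ-≤ _ (pred-mono-≤ 5≤q))

pair-certificate : ∀ {x y} → 2 ≤ x → ∃[ s ] 67 + s ≡ y → ∃[ Y ] 28 + Y ≤ 12 + pred x * (pred y * 1) × 36 * y < Y * Y
pair-certificate {x} 2≤x (s , refl) = 50 + s , bound , square
  where
  open ≤-Reasoning
  regroup : ∀ s → 28 + (50 + s) ≡ 12 + 1 * ((66 + s) * 1)
  regroup = solve-∀
  expand : ∀ s → 36 * (67 + s) + (88 + 64 * s + s * s) ≡ (50 + s) * (50 + s)
  expand = solve-∀
  bound : 28 + (50 + s) ≤ 12 + pred x * ((66 + s) * 1)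
  bound = begin
    28 + (50 + s)                ≡⟨ regroup s ⟩
    12 + 1 * ((66 + s) * 1)      ≤⟨ +-monoʳ-≤ 12 (*-monoˡ-≤ ((66 + s) * 1) (pred-mono-≤ 2≤x)) ⟩
    12 + pred x * ((66 + s) * 1) ∎
  square : 36 * (67 + s) < (50 + s) * (50 + s)
  square = begin-strict
    36 * (67 + s)                         <⟨ m<m+n _ (s≤s z≤n) ⟩
    36 * (67 + s) + (88 + 64 * s + s * s) ≡⟨ expand s ⟩
    (50 + s) * (50 + s)                   ∎

quadruple-certificate : ∀ {a b c d} → 2 ≤ a → 3 ≤ b → 5 ≤ c → ∃[ s ] 17 + s ≡ d →
  ∃[ Y ] 112 + Y ≤ 12 + pred a * (pred b * (pred c * (pred d * 1))) × 36 * d < Y * Y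
quadruple-certificate {a} {b} {c} 2≤a 3≤b 5≤c (s , refl) = 28 + 8 * s , bound , square
  where
  open ≤-Reasoning
  regroup : ∀ s → 112 + (28 + 8 * s) ≡ 12 + 1 * (2 * (4 * ((16 + s) * 1)))
  regroup = solve-∀
  expand : ∀ s → 36 * (17 + s) + (172 + 412 * s + 64 * (s * s)) ≡ (28 + 8 * s) * (28 + 8 * s)
  expand = solve-∀
  bound : 112 + (28 + 8 * s) ≤ 12 + pred a * (pred b * (pred c * ((16 + s) * 1)))
  bound = begin
    112 + (28 + 8 * s)                                 ≡⟨ regroup s ⟩
    12 + 1 * (2 * (4 * ((16 + s) * 1)))
      ≤⟨ +-monoʳ-≤ 12 (*-mono-≤ (pred-mono-≤ 2≤a) (*-mono-≤ (pred-mono-≤ 3≤b) (*-monoˡ-≤ _ (pred-mono-≤ 5≤c)))) ⟩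
    12 + pred a * (pred b * (pred c * ((16 + s) * 1))) ∎
  square : 36 * (17 + s) < (28 + 8 * s) * (28 + 8 * s)
  square = begin-strict
    36 * (17 + s)                                 <⟨ m<m+n _ (s≤s z≤n) ⟩
    36 * (17 + s) + (172 + 412 * s + 64 * (s * s)) ≡⟨ expand s ⟩
    (28 + 8 * s) * (28 + 8 * s)                   ∎

many-certificate : ∀ {r t f} → ∃[ k ] 5 + k ≡ r → ∃[ u ] 16 + u ≡ t → pred r * (t * t) ≤ 2 * f →
  7 * (2 * (2 * t)) + (6 * r + 1) ≤ 12 + f × 36 * r < (6 * r + 1) * (6 * r + 1)
many-certificate {f = f} (k , refl) (u , refl) [r-1]t²≤2f = *-cancelˡ-≤ 2 doubled-bound , square
  where
  open ≤-Reasoning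
  expand-bound : ∀ k u → 2 * (7 * (2 * (2 * (16 + u))) + (6 * (5 + k) + 1)) + (90 + 72 * u + 4 * (u * u) + 244 * k + 32 * (k * u) + k * (u * u))
                         ≡ 24 + (4 + k) * ((16 + u) * (16 + u))
  expand-bound = solve-∀
  expand-square : ∀ k → 36 * (5 + k) + (781 + 336 * k + 36 * (k * k)) ≡ (6 * (5 + k) + 1) * (6 * (5 + k) + 1)
  expand-square = solve-∀
  doubled-bound : 2 * (7 * (2 * (2 * (16 + u))) + (6 * (5 + k) + 1)) ≤ 2 * (12 + f)
  doubled-bound = begin
    2 * (7 * (2 * (2 * (16 + u))) + (6 * (5 + k) + 1))
      ≤⟨ m≤m+n _ (90 + 72 * u + 4 * (u * u) + 244 * k + 32 * (k * u) + k * (u * u)) ⟩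
    2 * (7 * (2 * (2 * (16 + u))) + (6 * (5 + k) + 1)) + (90 + 72 * u + 4 * (u * u) + 244 * k + 32 * (k * u) + k * (u * u))
      ≡⟨ expand-bound k u ⟩
    24 + (4 + k) * ((16 + u) * (16 + u))
      ≤⟨ +-monoʳ-≤ 24 [r-1]t²≤2f ⟩
    24 + 2 * f
      ≡⟨ *-distribˡ-+ 2 12 f ⟨
    2 * (12 + f) ∎
  square : 36 * (5 + k) < (6 * (5 + k) + 1) * (6 * (5 + k) + 1)
  square = begin-strict
    36 * (5 + k)                                 <⟨ m<m+n _ (s≤s z≤n) ⟩
    36 * (5 + k) + (781 + 336 * k + 36 * (k * k)) ≡⟨ expand-square k ⟩
    (6 * (5 + k) + 1) * (6 * (5 + k) + 1)         ∎

two-primes : ∀ {x y} → Prime x → Prime y → x < y → product (x ∷ y ∷ []) ∉ exceptional → Below4g² (x ∷ y ∷ []) y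
two-primes {x} {y} x-prime y-prime x<y ∉E with y <? 67
... | yes y<67 = All.lookup (All.lookup pairsBelow67 (∈-primesBelow x-prime (<-trans x<y y<67))) (∈-primesBelow y-prime y<67) x<y ∉E
... | no  y≮67 =
  let Y , bound , square = pair-certificate (prime⇒2≤ x-prime) (m≤n⇒∃[o]m+o≡n (≮⇒≥ y≮67))
  in below4g²-by (x ∷ y ∷ []) y Y bound square

four-primes : ∀ {a b c d} → All Prime (a ∷ b ∷ c ∷ d ∷ []) → a < b → b < c → c < d → Below4g² (a ∷ b ∷ c ∷ d ∷ []) d
four-primes {a} {b} {c} {d} (a-prime ∷ b-prime ∷ c-prime ∷ d-prime ∷ []) a<b b<c c<d with d <? 17
... | yes d<17 = All.lookup (All.lookup (All.lookup (All.lookup quadruplesBelow17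
      (below17 a-prime (<⇒≤ (<-trans a<b (<-trans b<c c<d))))) (below17 b-prime (<⇒≤ (<-trans b<c c<d))))
      (below17 c-prime (<⇒≤ c<d))) (below17 d-prime ≤-refl)
      a<b b<c c<d
  where
  below17 : ∀ {q} → Prime q → q ≤ d → q ∈ primesBelow 17
  below17 q-prime q≤d = ∈-primesBelow q-prime (≤-<-trans q≤d d<17)
... | no  d≮17 =
  let Y , bound , square = quadruple-certificate 2≤a 3≤b (prime-4≤⇒5≤ c-prime (≤-trans (s≤s 3≤b) b<c))
                                                 (m≤n⇒∃[o]m+o≡n (≮⇒≥ d≮17))
  in below4g²-by (a ∷ b ∷ c ∷ d ∷ []) d Y bound square
  where
  2≤a = prime⇒2≤ a-prime
  3≤b = ≤-trans (s≤s 2≤a) a<b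

many-primes : ∀ {q₁ q₂ R r} → AllPairs _<_ (q₁ ∷ q₂ ∷ R) → All Prime (q₁ ∷ q₂ ∷ R) → 4 ≤ length R → r ∈ R →
              Below4g² (q₁ ∷ q₂ ∷ R) r
many-primes {q₁} {q₂} {R} {r} ((q₁<q₂ ∷ _) ∷ q₂<R ∷ _) (q₁-prime ∷ q₂-prime ∷ R-prime) 4≤|R| r∈R =
  let bound , square = many-certificate (m≤n⇒∃[o]m+o≡n (All.lookup 5≤R r∈R)) (m≤n⇒∃[o]m+o≡n (^-monoʳ-≤ 2 4≤|R|))
                                        [r-1]t²≤2φ
  in below4g²-by (q₁ ∷ q₂ ∷ R) r (6 * r + 1) bound square
  where
  open ≤-Reasoning
  2≤q₁ = prime⇒2≤ q₁-prime
  3≤q₂ = ≤-trans (s≤s 2≤q₁) q₁<q₂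
  5≤R : All (5 ≤_) R
  5≤R = All.zipWith (λ (q₂<q , q-prime) → prime-4≤⇒5≤ q-prime (≤-trans (s≤s 3≤q₂) q₂<q)) (q₂<R , R-prime)
  t = 2 ^ length R
  ΠR = product (map pred R)
  4≡2*[1*2] : ∀ n → 4 * n ≡ 2 * (1 * (2 * n))
  4≡2*[1*2] = solve-∀
  [r-1]t²≤2φ : pred r * (t * t) ≤ 2 * (pred q₁ * (pred q₂ * ΠR))
  [r-1]t²≤2φ = begin
    pred r * (t * t)              ≤⟨ pred*2^length²≤ 5≤R r∈R ⟩
    4 * ΠR                        ≡⟨ 4≡2*[1*2] ΠR ⟩
    2 * (1 * (2 * ΠR))            ≤⟨ *-monoʳ-≤ 2 (*-mono-≤ (pred-mono-≤ 2≤q₁) (*-monoˡ-≤ ΠR (pred-mono-≤ 3≤q₂))) ⟩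
    2 * (pred q₁ * (pred q₂ * ΠR)) ∎

below4g² : ∀ L {p} → AllPairs _<_ L → All Prime L → length L % 2 ≡ 0 → product L ∉ exceptional → p ∈ L → Below4g² L p
below4g² (x ∷ y ∷ []) increasing@((x<y ∷ []) ∷ [] ∷ []) (x-prime ∷ y-prime ∷ []) _ ∉E p∈L =
  below4g²-mono (x ∷ y ∷ []) (≤-last (x ∷ []) increasing p∈L) (two-primes x-prime y-prime x<y ∉E)
below4g² (a ∷ b ∷ c ∷ d ∷ []) increasing@((a<b ∷ _) ∷ (b<c ∷ _) ∷ (c<d ∷ []) ∷ [] ∷ []) primes _ _ p∈L =
  below4g²-mono (a ∷ b ∷ c ∷ d ∷ []) (≤-last (a ∷ b ∷ c ∷ []) increasing p∈L) (four-primes primes a<b b<c c<d)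
below4g² (q₁ ∷ q₂ ∷ R@(r ∷ _ ∷ _ ∷ _ ∷ _)) increasing@((_ ∷ q₁<r ∷ _) ∷ (q₂<r ∷ _) ∷ _) primes _ _ p∈L =
  bound-at p∈L
  where
  bound-in-R : ∀ {r′} → r′ ∈ R → Below4g² (q₁ ∷ q₂ ∷ R) r′
  bound-in-R = many-primes increasing primes (s≤s (s≤s (s≤s (s≤s z≤n))))
  bound-at : ∀ {p} → p ∈ q₁ ∷ q₂ ∷ R → Below4g² (q₁ ∷ q₂ ∷ R) p
  bound-at (here refl)         = below4g²-mono (q₁ ∷ q₂ ∷ R) (<⇒≤ q₁<r) (bound-in-R (here refl))
  bound-at (there (here refl)) = below4g²-mono (q₁ ∷ q₂ ∷ R) (<⇒≤ q₂<r) (bound-in-R (here refl))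
  bound-at (there (there p∈R)) = bound-in-R p∈R
below4g² (_ ∷ [])                 _ _ () _ _
below4g² (_ ∷ _ ∷ _ ∷ [])         _ _ () _ _
below4g² (_ ∷ _ ∷ _ ∷ _ ∷ _ ∷ []) _ _ () _ _

lemma3p2 : (D : ℕ) → 1 < D → Squarefree D → length (primeDivisors D) % 2 ≡ 0 → D ∉ exceptional
    → (p : ℕ) → Prime p → p ∣ D → ((+ p) ℚ./ 1) ℚ.< (((+ 4) ℚ./ 1) ℚ.* (genus D ℚ.* genus D))
lemma3p2 D 1<D squarefree even D∉ℰ p p-prime p∣D =
  36p<X²⇒p<4g² p (genus D) _ (toℚᵘ-genus D)
    (subst (λ X → + (36 * p) ℤ.< X ℤ.* X) (sym numerator≡)
      (below4g² L increasing primes even (subst (_∉ exceptional) (sym ΠL≡D) D∉ℰ) (∈-primeDivisors p-prime p∣D)))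
  where
  instance
    D≢0 : NonZero D
    D≢0 = >-nonZero (<-trans z<s 1<D)
  L = primeDivisors D
  increasing = primeDivisors-increasing D
  primes = All.map proj₁ (primeDivisors-prime∣ D)
  ΠL≡D = product-primeDivisors squarefree
  numerator≡ : genusNumerator (φ D) (primeProd -[1+ 3 ] D) (primeProd -[1+ 2 ] D) ≡ numerator L
  numerator≡ = trans (cong (λ f → genusNumerator f (primeProd -[1+ 3 ] D) (primeProd -[1+ 2 ] D)) (φ-squarefree squarefree))
    (cong₂ (genusNumerator (product (map pred L))) (primeProd≡product -[1+ 3 ] D) (primeProd≡product -[1+ 2 ] D))
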